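{- For every integer $k\ge 3$ (fixed, with implied constants depending on $k$), \[ \mathcal C_{k}(n) = \begin{cases} O\left(n \cdot u_2(n)^{k/3}\right) & \text{if } k\equiv 0 \pmod{3}, \\ O\left(u_2(n)^{(k+2)/3}\right) & \text{if } k\equiv 1 \pmod{3}, \\ O\left(n^2\cdot u_2(n)^{(k-2)/3}\right) & \text{if } k\equiv 2 \pmod{3}. \end{cases} \]
   Context: For points $p,q\in\mathbb{R}^2$, $|pq|$ denotes the Euclidean distance. $u_2(n)$ denotes the maximum, over all sets of $n$ points in $\mathbb{R}^2$, of the number of pairs of points at distance exactly $1$ (Erdős's unit distances function). Given a finite set $\mathcal P\subset\mathbb{R}^2$, a positive integer $k$, and a sequence of positive distances $(\delta_1,\ldots,\delta_k)$, a $k$-chain is a $(k+1)$-tuple of distinct points $(p_1,\ldots,p_{k+1})\in\mathcal P^{k+1}$ with $|p_jp_{j+1}|=\delta_j$ for every $1\le j\le k$. $\mathcal C_k(n)$ denotes the maximum, over all sets $\mathcal P$ of $n$ points in $\mathbb{R}^2$ and all sequences of distances $(\delta_1,\ldots,\delta_k)$, of the number of $k$-chains. -}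

module Defs where

open import Level using (0ℓ)
open import Data.Nat as ℕ using (ℕ; zero; suc; _/_; _%_; _∸_; _^_)
open import Data.Fin using (Fin)
import Data.Fin as Fin
open import Data.Vec using (Vec; lookup; toList)
open import Data.List using (List; length)
open import Data.List.Relation.Unary.All using (All)
open import Data.List.Relation.Unary.Unique.Propositional using (Unique)
open import Data.Product using (Σ; ∃; _×_; _,_)
open import Data.Sum using (_⊎_)
open import Relation.Nullary using (¬_)
open import Relation.Binary.PropositionalEquality using (_≡_; _≢_)
open import Relation.Binary.Structures using (IsStrictTotalOrder)
open import Algebra.Structures using (IsCommutativeRing)
open import Function.Definitions using (Injective)

-- The real numbers, given axiomatically as a complete ordered field
-- (unique up to isomorphism), since agda-stdlib has no reals.
record RealField : Set₁ where
  infixl 6 _+_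
  infixl 7 _*_
  infix 4 _<_ _≤_
  field
    Carrier : Set
    _+_ _*_ : Carrier → Carrier → Carrier
    -_ : Carrier → Carrier
    0# 1# : Carrier
    _<_ : Carrier → Carrier → Set
    isCommutativeRing : IsCommutativeRing _≡_ _+_ _*_ -_ 0# 1#
    0≢1 : 0# ≢ 1#
    inverse : ∀ x → x ≢ 0# → ∃ λ y → x * y ≡ 1#
    isStrictTotalOrder : IsStrictTotalOrder _≡_ _<_
    +-mono-< : ∀ {x y} z → x < y → x + z < y + z
    *-pos : ∀ {x y} → 0# < x → 0# < y → 0# < x * y

  _≤_ : Carrier → Carrier → Set
  x ≤ y = x < y ⊎ x ≡ y

  _-_ : Carrier → Carrier → Carrier
  x - y = x + (- y)

  field
    complete : (S : Carrier → Set) → (∃ λ x → S x) →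
               (∃ λ b → ∀ x → S x → x ≤ b) →
               ∃ λ l → (∀ x → S x → x ≤ l) × (∀ b → (∀ x → S x → x ≤ b) → l ≤ b)

module Plane (R : RealField) where
  open RealField R

  Point : Set
  Point = Carrier × Carrier

  dist² : Point → Point → Carrier
  dist² (x₁ , y₁) (x₂ , y₂) = (x₁ - x₂) * (x₁ - x₂) + (y₁ - y₂) * (y₁ - y₂)

  -- |pq| = δ  for δ > 0  (equivalently |pq|² = δ²)
  AtDist : Point → Point → Carrier → Set
  AtDist p q δ = dist² p q ≡ δ * δ

  PointSet : ℕ → Set
  PointSet n = Σ (Fin n → Point) Injective'
    where Injective' : (Fin n → Point) → Set
          Injective' f = Injective _≡_ _≡_ f

  -- an unordered pair {i,j} of points, represented as i < j, at distance 1
  UnitPair : ∀ {n} → PointSet n → Fin n × Fin n → Set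
  UnitPair (f , _) (i , j) = (i Fin.< j) × AtDist (f i) (f j) 1#

  -- u is an upper bound on the number of unit-distance pairs of every n-point set
  -- (u₂(n) is the least such u)
  UnitDistBound : ℕ → ℕ → Set
  UnitDistBound n u = (P : PointSet n) (ps : List (Fin n × Fin n)) →
    Unique ps → All (UnitPair P) ps → length ps ℕ.≤ u

  IsChain : ∀ {n} k → PointSet n → (Fin k → Carrier) → Vec (Fin n) (suc k) → Set
  IsChain k (f , _) δ c =
    Injective _≡_ _≡_ (lookup c) ×
    (∀ (j : Fin k) → AtDist (f (lookup c (Fin.inject₁ j))) (f (lookup c (Fin.suc j))) (δ j))

chainBound : ℕ → ℕ → ℕ → ℕ
chainBound k n u = go (k % 3)
  where
  go : ℕ → ℕ
  go 0 = n ℕ.* u ^ (k / 3)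
  go 1 = u ^ ((k ℕ.+ 2) / 3)
  go _ = n ℕ.* n ℕ.* u ^ ((k ∸ 2) / 3)

-- Write k = 3m + r. An ordered pair of points at distance δ > 0 becomes a unit pair after
-- scaling by 1/δ, so there are at most 2u₂(n) of them. Once the first and third vertices of a
-- chain are fixed, the second lies on two circles with distinct centres, so it has at most two
-- choices: three common points would lie on the radical axis, a line meeting a circle at most
-- twice. Hence the 3m-chains from a fixed start number at most (4u₂(n))^m: the third and fourth
-- vertices form a δ-pair, the chain continues from the fourth, and the second vertex is one of
-- two points. For r = 0, 1, 2 one prepends one of n starts, a δ-pair, or a start together with
-- one of two second vertices.
module Submission where

open import Defs
open import Level using (0ℓ)
open import Algebra.Bundles using (CommutativeRing)
open import Algebra.Core using (Op₁; Op₂)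
open import Data.Bool using (true; false)
open import Data.Empty using (⊥-elim)
open import Data.Fin as Fin using (Fin)
import Data.Fin.Properties as Fin
open import Data.List using (List; []; _∷_; length; map; filter; deduplicate; allFin)
open import Data.List.Properties using (length-map; length-tabulate)
open import Data.List.Membership.Propositional using (_∈_)
open import Data.List.Membership.Propositional.Properties using (∈-deduplicate⁺; ∈-map⁺; ∈-allFin)
open import Data.List.Relation.Unary.All as All using (All; []; _∷_)
import Data.List.Relation.Unary.All.Properties as All
open import Data.List.Relation.Unary.AllPairs using ([]; _∷_)
open import Data.List.Relation.Unary.Any using (here; there)
open import Data.List.Relation.Unary.Unique.Propositional using (Unique)
import Data.List.Relation.Unary.Unique.Propositional.Properties as Unique
open import Data.List.Relation.Unary.Unique.DecPropositional.Properties using (deduplicate-!)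
open import Data.Nat as ℕ using (ℕ; zero; suc)
open import Data.Nat.Tactic.RingSolver using (solve-∀)
open import Data.Product using (∃₂; _×_; _,_; proj₁; proj₂; swap)
import Data.Product.Properties as Product
open import Data.Sum using (inj₁; inj₂)
open import Data.Unit using (⊤; tt)
open import Data.Vec using (Vec; []; _∷_; head; tail)
import Data.Vec.Properties as Vec
open import Function using (_∘_)
open import Relation.Binary.Definitions using (DecidableEquality; tri<; tri≈; tri>)
open import Relation.Binary.PropositionalEquality
  using (_≡_; _≢_; refl; sym; trans; cong; cong₂; subst; subst₂; module ≡-Reasoning)
open import Relation.Binary.Structures using (IsStrictTotalOrder)
open import Relation.Nullary using (¬_; does; yes; no)
open import Relation.Unary using (Decidable)
open import Relation.Unary.Properties using (∁?)

-- With ℤ as coefficient ring the solver normalises by computing in ℤ, so it also proves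
-- identities with subtraction in a ring whose carrier is abstract, such as RealField.
module IntegerCoefficients {c ℓ} (commutativeRing : CommutativeRing c ℓ) where

  open CommutativeRing commutativeRing
    using (Carrier; _≈_; _+_; _*_; -_; 0#; 1#; setoid; reflexive; +-congˡ; +-congʳ; *-cong;
           -‿cong; +-comm; +-identityˡ; +-identityʳ; -‿inverseʳ; zeroʳ; *-identityˡ; *-identityʳ;
           ring; semiring; +-abelianGroup; +-commutativeSemigroup; *-commutativeSemigroup)
    renaming (refl to ≈-refl; sym to ≈-sym; trans to ≈-trans)
  open import Algebra.Solver.Ring.AlmostCommutativeRing
    using (_-Raw-AlmostCommutative⟶_; fromCommutativeRing)
  open import Data.Integer as ℤ using (ℤ; +_; -[1+_]; _⊖_; _◃_; sign; ∣_∣)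
  import Data.Integer.Properties as ℤ
  open import Data.Maybe using (Maybe; just; nothing)
  open import Data.Nat.Properties using (+-suc)
  open import Data.Sign as Sign using (Sign)
  open import Algebra.Properties.Ring ring using (-1*x≈-x; -‿involutive; -0#≈0#)
  open import Algebra.Properties.AbelianGroup +-abelianGroup using (⁻¹-∙-comm)
  open import Algebra.Properties.CommutativeSemigroup +-commutativeSemigroup
    using () renaming (interchange to +-interchange)
  open import Algebra.Properties.CommutativeSemigroup *-commutativeSemigroup
    using () renaming (interchange to *-interchange)
  open import Algebra.Properties.Semiring.Mult semiring using (×-homo-+; ×1-homo-*)
    renaming (_×_ to _·_)
  open import Relation.Binary.Reasoning.Setoid setoid

  ⟦_⟧ : ℤ → Carrier
  ⟦ + n ⟧ = n · 1#
  ⟦ -[1+ n ] ⟧ = - (suc n · 1#)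

  ⟦_⟧ₛ : Sign → Carrier
  ⟦ Sign.+ ⟧ₛ = 1#
  ⟦ Sign.- ⟧ₛ = - 1#

  ⟦⟧ₛ-*-homo : ∀ s t → ⟦ s Sign.* t ⟧ₛ ≈ ⟦ s ⟧ₛ * ⟦ t ⟧ₛ
  ⟦⟧ₛ-*-homo Sign.+ t = ≈-sym (*-identityˡ _)
  ⟦⟧ₛ-*-homo Sign.- Sign.+ = ≈-sym (*-identityʳ _)
  ⟦⟧ₛ-*-homo Sign.- Sign.- = ≈-sym (≈-trans (-1*x≈-x _) (-‿involutive _))

  ⟦◃⟧ : ∀ s n → ⟦ s ◃ n ⟧ ≈ ⟦ s ⟧ₛ * (n · 1#)
  ⟦◃⟧ s zero = ≈-sym (zeroʳ _)
  ⟦◃⟧ Sign.+ (suc n) = ≈-sym (*-identityˡ _)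
  ⟦◃⟧ Sign.- (suc n) = ≈-sym (-1*x≈-x _)

  ⟦⟧-signAbs : ∀ i → ⟦ i ⟧ ≈ ⟦ sign i ⟧ₛ * (∣ i ∣ · 1#)
  ⟦⟧-signAbs i = ≈-trans (reflexive (cong ⟦_⟧ (sym (ℤ.◃-inverse i)))) (⟦◃⟧ (sign i) ∣ i ∣)

  ⟦⊖⟧ : ∀ m n → ⟦ m ⊖ n ⟧ ≈ m · 1# + - (n · 1#)
  ⟦⊖⟧ m zero = ≈-sym (≈-trans (+-congˡ -0#≈0#) (+-identityʳ _))
  ⟦⊖⟧ zero (suc n) = ≈-sym (+-identityˡ _)
  ⟦⊖⟧ (suc m) (suc n) = begin
    ⟦ suc m ⊖ suc n ⟧                        ≡⟨ cong ⟦_⟧ (ℤ.[1+m]⊖[1+n]≡m⊖n m n) ⟩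
    ⟦ m ⊖ n ⟧                                ≈⟨ ⟦⊖⟧ m n ⟩
    m · 1# + - (n · 1#)                      ≈⟨ +-identityˡ _ ⟨
    0# + (m · 1# + - (n · 1#))               ≈⟨ +-congʳ (-‿inverseʳ 1#) ⟨
    (1# + - 1#) + (m · 1# + - (n · 1#))      ≈⟨ +-interchange _ _ _ _ ⟩
    (1# + m · 1#) + (- 1# + - (n · 1#))      ≈⟨ +-congˡ (⁻¹-∙-comm 1# (n · 1#)) ⟩
    suc m · 1# + - (suc n · 1#)              ∎

  +-homo : ∀ i j → ⟦ i ℤ.+ j ⟧ ≈ ⟦ i ⟧ + ⟦ j ⟧
  +-homo (+ m) (+ n) = ×-homo-+ 1# m n
  +-homo (+ m) -[1+ n ] = ⟦⊖⟧ m (suc n)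
  +-homo -[1+ m ] (+ n) = ≈-trans (⟦⊖⟧ n (suc m)) (+-comm _ _)
  +-homo -[1+ m ] -[1+ n ] = begin
    - (suc (suc (m ℕ.+ n)) · 1#)              ≡⟨ cong (λ k → - (k · 1#)) (+-suc (suc m) n) ⟨
    - ((suc m ℕ.+ suc n) · 1#)                ≈⟨ -‿cong (×-homo-+ 1# (suc m) (suc n)) ⟩
    - (suc m · 1# + suc n · 1#)               ≈⟨ ⁻¹-∙-comm _ _ ⟨
    - (suc m · 1#) + - (suc n · 1#)           ∎

  *-homo : ∀ i j → ⟦ i ℤ.* j ⟧ ≈ ⟦ i ⟧ * ⟦ j ⟧
  *-homo i j = begin
    ⟦ sign i Sign.* sign j ◃ ∣ i ∣ ℕ.* ∣ j ∣ ⟧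
      ≈⟨ ⟦◃⟧ (sign i Sign.* sign j) (∣ i ∣ ℕ.* ∣ j ∣) ⟩
    ⟦ sign i Sign.* sign j ⟧ₛ * ((∣ i ∣ ℕ.* ∣ j ∣) · 1#)
      ≈⟨ *-cong (⟦⟧ₛ-*-homo (sign i) (sign j)) (×1-homo-* ∣ i ∣ ∣ j ∣) ⟩
    (⟦ sign i ⟧ₛ * ⟦ sign j ⟧ₛ) * ((∣ i ∣ · 1#) * (∣ j ∣ · 1#))
      ≈⟨ *-interchange _ _ _ _ ⟩
    (⟦ sign i ⟧ₛ * (∣ i ∣ · 1#)) * (⟦ sign j ⟧ₛ * (∣ j ∣ · 1#))
      ≈⟨ *-cong (⟦⟧-signAbs i) (⟦⟧-signAbs j) ⟨
    ⟦ i ⟧ * ⟦ j ⟧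
      ∎

  -‿homo : ∀ i → ⟦ ℤ.- i ⟧ ≈ - ⟦ i ⟧
  -‿homo -[1+ n ] = ≈-sym (-‿involutive _)
  -‿homo (+ zero) = ≈-sym -0#≈0#
  -‿homo (+ suc n) = ≈-refl

  homomorphism : ℤ.+-*-rawRing -Raw-AlmostCommutative⟶ fromCommutativeRing commutativeRing
  homomorphism = record
    { ⟦_⟧ = ⟦_⟧ ; +-homo = +-homo ; *-homo = *-homo ; -‿homo = -‿homo
    ; 0-homo = ≈-refl ; 1-homo = +-identityʳ 1# }

  ⟦⟧-weaklyDecidable : ∀ i j → Maybe (⟦ i ⟧ ≈ ⟦ j ⟧)
  ⟦⟧-weaklyDecidable i j with i ℤ.≟ j
  ... | yes refl = just ≈-refl
  ... | no _ = nothing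

  open import Algebra.Solver.Ring ℤ.+-*-rawRing (fromCommutativeRing commutativeRing)
    homomorphism ⟦⟧-weaklyDecidable public
    using (Polynomial; solve; _:+_; _:*_; _:-_; :-_; _:=_)

module Counting where
  open import Data.Nat using (_≤_; _+_; _*_; z≤n; s≤s)
  open import Data.Nat.Properties
    using (≤-trans; +-mono-≤; *-monoʳ-≤; *-suc; *-identityˡ; +-suc; module ≤-Reasoning)

  private variable
    A B : Set
    Q Q′ : A → Set
    K M N : ℕ

  AtMost : ℕ → (A → Set) → Set
  AtMost {A} M Q = (xs : List A) → Unique xs → All Q xs → length xs ≤ M

  AtMost-≤ : M ≤ N → AtMost M Q → AtMost N Q
  AtMost-≤ M≤N bound xs xs! Qxs = ≤-trans (bound xs xs! Qxs) M≤N

  AtMost-injection : (h : A → B) → (∀ {a} → Q a → Q′ (h a)) →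
                     (∀ {a a′} → Q a → Q a′ → h a ≡ h a′ → a ≡ a′) →
                     AtMost M Q′ → AtMost M Q
  AtMost-injection {Q = Q} {M = M} h Q⇒Q′ h-inj bound xs xs! Qxs =
    subst (_≤ M) (length-map h xs)
      (bound (map h xs) (map-unique xs xs! Qxs) (All.map⁺ (All.map Q⇒Q′ Qxs)))
    where
    map-unique : ∀ xs → Unique xs → All Q xs → Unique (map h xs)
    map-unique [] [] [] = []
    map-unique (x ∷ xs) (x∉xs ∷ xs!) (Qx ∷ Qxs) =
      All.map⁺ (All.zipWith (λ (x≢y , Qy) hx≡hy → x≢y (h-inj Qx Qy hx≡hy)) (x∉xs , Qxs))
      ∷ map-unique xs xs! Qxs

  AtMost-⊆ : (∀ {a} → Q a → Q′ a) → AtMost M Q′ → AtMost M Q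
  AtMost-⊆ Q⇒Q′ = AtMost-injection (λ a → a) Q⇒Q′ (λ _ _ a≡a′ → a≡a′)

  length-filter+∁ : ∀ {P : A → Set} (P? : Decidable P) xs →
                    length (filter P? xs) + length (filter (∁? P?) xs) ≡ length xs
  length-filter+∁ P? [] = refl
  length-filter+∁ P? (x ∷ xs) with does (P? x)
  ... | true = cong suc (length-filter+∁ P? xs)
  ... | false = trans (+-suc _ _) (cong suc (length-filter+∁ P? xs))

  module _ (g : A → B) (_≟_ : DecidableEquality B) where

    length≤fibre*length : (∀ b → AtMost K (λ a → Q a × g a ≡ b)) → ∀ L xs → Unique xs → All Q xs →
                          All (λ a → g a ∈ L) xs → length xs ≤ K * length L
    length≤fibre*length fibre [] [] _ _ _ = z≤n
    length≤fibre*length fibre [] (x ∷ xs) _ _ (() ∷ _)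
    length≤fibre*length {K = K} fibre (b ∷ L) xs xs! Qxs gxs∈ = begin
      length xs                                  ≡⟨ length-filter+∁ P? xs ⟨
      length (filter P? xs) + length outside     ≤⟨ +-mono-≤ in-fibre outside-fibre ⟩
      K + K * length L                           ≡⟨ *-suc K (length L) ⟨
      K * suc (length L)                         ∎
      where
      open ≤-Reasoning
      P? : Decidable (λ a → g a ≡ b)
      P? a = g a ≟ b
      outside : List A
      outside = filter (∁? P?) xs
      in-fibre : length (filter P? xs) ≤ K
      in-fibre = fibre b (filter P? xs) (Unique.filter⁺ P? xs!)
                   (All.zip (All.filter⁺ P? Qxs , All.all-filter P? xs))
      in-L : ∀ {a} → g a ∈ b ∷ L × ¬ g a ≡ b → g a ∈ L
      in-L (here ga≡b , ga≢b) = ⊥-elim (ga≢b ga≡b)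
      in-L (there ga∈L , _) = ga∈L
      outside-fibre : length outside ≤ K * length L
      outside-fibre = length≤fibre*length fibre L outside (Unique.filter⁺ (∁? P?) xs!)
                        (All.filter⁺ (∁? P?) Qxs)
                        (All.zipWith in-L (All.filter⁺ (∁? P?) gxs∈ , All.all-filter (∁? P?) xs))

    AtMost-fibres : (∀ {a} → Q a → Q′ (g a)) → (∀ b → AtMost K (λ a → Q a × g a ≡ b)) →
                    AtMost M Q′ → AtMost (K * M) Q
    AtMost-fibres {K = K} Q⇒Q′ fibre bound xs xs! Qxs = ≤-trans
      (length≤fibre*length fibre image xs xs! Qxs (All.tabulate (∈-deduplicate⁺ _≟_ ∘ ∈-map⁺ g)))
      (*-monoʳ-≤ K (bound image (deduplicate-! _≟_ (map g xs))
                                (All.deduplicate⁺ _≟_ (All.map⁺ (All.map Q⇒Q′ Qxs)))))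
      where
      image : List B
      image = deduplicate _≟_ (map g xs)

  AtMost-≡ : ∀ (a : A) → AtMost 1 (_≡ a)
  AtMost-≡ a [] _ _ = z≤n
  AtMost-≡ a (x ∷ []) _ _ = s≤s z≤n
  AtMost-≡ a (x ∷ y ∷ xs) ((x≢y ∷ _) ∷ _) (x≡a ∷ y≡a ∷ _) = ⊥-elim (x≢y (trans x≡a (sym y≡a)))

  AtMost-∈ : DecidableEquality A → ∀ L → AtMost (length L) (_∈ L)
  AtMost-∈ _≟_ L xs xs! xs∈ = subst (length xs ≤_) (*-identityˡ (length L))
    (length≤fibre*length (λ a → a) _≟_ (λ a → AtMost-⊆ proj₂ (AtMost-≡ a)) L xs xs! xs∈ xs∈)

  AtMost-Fin : ∀ n → AtMost n (λ (_ : Fin n) → ⊤)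
  AtMost-Fin n = subst (λ m → AtMost m (λ (_ : Fin n) → ⊤)) (length-tabulate (λ i → i))
    (AtMost-⊆ (λ {i} _ → ∈-allFin i) (AtMost-∈ Fin._≟_ (allFin n)))

  AtMost-× : DecidableEquality A → AtMost M Q → AtMost N Q′ →
             AtMost (N * M) (λ (ab : A × B) → Q (proj₁ ab) × Q′ (proj₂ ab))
  AtMost-× _≟_ boundQ boundQ′ = AtMost-fibres proj₁ _≟_ proj₁
    (λ a → AtMost-injection proj₂ (λ ((_ , Q′b) , _) → Q′b)
             (λ { {_ , _} {_ , _} (_ , refl) (_ , refl) refl → refl }) boundQ′)
    boundQ

open Counting

module RealFieldProperties (R : RealField) where
  open RealField R

  commutativeRing : CommutativeRing 0ℓ 0ℓ
  commutativeRing = record { isCommutativeRing = isCommutativeRing }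

  open CommutativeRing commutativeRing public
    using (+-comm; *-comm; +-identityˡ; +-identityʳ; *-identityˡ; zeroʳ; -‿inverseʳ)
  open IntegerCoefficients commutativeRing public
    using (Polynomial; solve; _:+_; _:*_; _:-_; :-_; _:=_)
  open IsStrictTotalOrder isStrictTotalOrder public using (_≟_; compare; irrefl)
    renaming (trans to <-trans)

  0<x⇒x≢0 : ∀ {x} → 0# < x → x ≢ 0#
  0<x⇒x≢0 0<x refl = irrefl refl 0<x

  x≢0∧x*y≡0⇒y≡0 : ∀ {x y} → x ≢ 0# → x * y ≡ 0# → y ≡ 0#
  x≢0∧x*y≡0⇒y≡0 {x} {y} x≢0 xy≡0 with inverse x x≢0
  ... | x⁻¹ , xx⁻¹≡1 = begin
    y               ≡⟨ *-identityˡ y ⟨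
    1# * y          ≡⟨ cong (_* y) xx⁻¹≡1 ⟨
    (x * x⁻¹) * y   ≡⟨ solve 3 (λ x y x⁻¹ → (x :* x⁻¹) :* y := x⁻¹ :* (x :* y)) refl x y x⁻¹ ⟩
    x⁻¹ * (x * y)   ≡⟨ cong (x⁻¹ *_) xy≡0 ⟩
    x⁻¹ * 0#        ≡⟨ zeroʳ x⁻¹ ⟩
    0#              ∎
    where open ≡-Reasoning

  x<0⇒0<-x : ∀ {x} → x < 0# → 0# < - x
  x<0⇒0<-x {x} x<0 = subst₂ _<_ (-‿inverseʳ x) (+-identityˡ (- x)) (+-mono-< (- x) x<0)

  x≢0⇒0<x*x : ∀ {x} → x ≢ 0# → 0# < x * x
  x≢0⇒0<x*x {x} x≢0 with compare 0# x
  ... | tri< 0<x _ _ = *-pos 0<x 0<x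
  ... | tri≈ _ 0≡x _ = ⊥-elim (x≢0 (sym 0≡x))
  ... | tri> _ _ x<0 = subst (0# <_) (solve 1 (λ x → (:- x) :* (:- x) := x :* x) refl x)
                         (*-pos (x<0⇒0<-x x<0) (x<0⇒0<-x x<0))

  0≤x*x : ∀ x → 0# ≤ x * x
  0≤x*x x with x ≟ 0#
  ... | yes refl = inj₂ (sym (zeroʳ 0#))
  ... | no x≢0 = inj₁ (x≢0⇒0<x*x x≢0)

  0<x⇒0≤y⇒0<x+y : ∀ {x y} → 0# < x → 0# ≤ y → 0# < x + y
  0<x⇒0≤y⇒0<x+y {x} {y} 0<x 0≤y with 0≤y | subst (_< x + y) (+-identityˡ y) (+-mono-< y 0<x)
  ... | inj₁ 0<y | y<x+y = <-trans 0<y y<x+y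
  ... | inj₂ refl | y<x+y = y<x+y

  x*x+y*y≡0⇒x≡0 : ∀ x y → x * x + y * y ≡ 0# → x ≡ 0#
  x*x+y*y≡0⇒x≡0 x y h with x ≟ 0#
  ... | yes x≡0 = x≡0
  ... | no x≢0 = ⊥-elim (0<x⇒x≢0 (0<x⇒0≤y⇒0<x+y (x≢0⇒0<x*x x≢0) (0≤x*x y)) h)

  x+x≡0⇒x≡0 : ∀ {x} → x + x ≡ 0# → x ≡ 0#
  x+x≡0⇒x≡0 {x} h = x*x+y*y≡0⇒x≡0 x x (begin
    x * x + x * x  ≡⟨ solve 1 (λ x → x :* x :+ x :* x := x :* (x :+ x)) refl x ⟩
    x * (x + x)    ≡⟨ cong (x *_) h ⟩
    x * 0#         ≡⟨ zeroʳ x ⟩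
    0#             ∎)
    where open ≡-Reasoning

  x≡y⇒x-y≡0 : ∀ {x y} → x ≡ y → x - y ≡ 0#
  x≡y⇒x-y≡0 {x} refl = -‿inverseʳ x

  combination₂≡0 : ∀ {x e₁ e₂} a₁ a₂ → x ≡ a₁ * e₁ + a₂ * e₂ → e₁ ≡ 0# → e₂ ≡ 0# → x ≡ 0#
  combination₂≡0 a₁ a₂ x≡ refl refl =
    trans x≡ (trans (cong₂ _+_ (zeroʳ a₁) (zeroʳ a₂)) (+-identityʳ 0#))

  combination₃≡0 : ∀ {x e₁ e₂ e₃} a₁ a₂ a₃ → x ≡ a₁ * e₁ + a₂ * e₂ + a₃ * e₃ →
                   e₁ ≡ 0# → e₂ ≡ 0# → e₃ ≡ 0# → x ≡ 0#
  combination₃≡0 a₁ a₂ a₃ x≡ e₁≡0 e₂≡0 refl =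
    combination₂≡0 a₁ a₂ (trans x≡ (trans (cong (_ +_) (zeroʳ a₃)) (+-identityʳ _))) e₁≡0 e₂≡0

  x-y≡0⇒x≡y : ∀ {x y} → x - y ≡ 0# → x ≡ y
  x-y≡0⇒x≡y {x} {y} h = begin
    x              ≡⟨ solve 2 (λ x y → x := (x :- y) :+ y) refl x y ⟩
    (x - y) + y    ≡⟨ cong (_+ y) h ⟩
    0# + y         ≡⟨ +-identityˡ y ⟩
    y              ∎
    where open ≡-Reasoning

  *-cancelˡ-≡ : ∀ {x y z} → x ≢ 0# → x * y ≡ x * z → y ≡ z
  *-cancelˡ-≡ {x} {y} {z} x≢0 xy≡xz = x-y≡0⇒x≡y (x≢0∧x*y≡0⇒y≡0 x≢0 (begin
    x * (y - z)         ≡⟨ solve 3 (λ x y z → x :* (y :- z) := x :* y :- x :* z) refl x y z ⟩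
    (x * y) - (x * z)   ≡⟨ x≡y⇒x-y≡0 xy≡xz ⟩
    0#                  ∎))
    where open ≡-Reasoning

-- Defined over an arbitrary signature so that the same operations can be written inside
-- ring-solver expressions (Syntax in PlaneGeometry).
module Vectors {A : Set} (_+_ _*_ : Op₂ A) (-_ : Op₁ A) where

  _-ᵥ_ : A × A → A × A → A × A
  (x₁ , x₂) -ᵥ (y₁ , y₂) = (x₁ + (- y₁)) , (x₂ + (- y₂))

  _∙_ : A × A → A × A → A
  (x₁ , x₂) ∙ (y₁ , y₂) = (x₁ * y₁) + (x₂ * y₂)

  det : A × A → A × A → A
  det (x₁ , x₂) (y₁ , y₂) = (x₁ * y₂) + (- (x₂ * y₁))

  ‖_‖² : A × A → A
  ‖ p ‖² = p ∙ p

  _*ᵥ_ : A → A × A → A × A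
  s *ᵥ (x₁ , x₂) = (s * x₁) , (s * x₂)

module PlaneGeometry (R : RealField) where
  open RealField R
  open RealFieldProperties R
  open Plane R using (Point; dist²)
  open Vectors _+_ _*_ -_ public
  open ≡-Reasoning

  open module Syntax {n} = Vectors {Polynomial n} _:+_ _:*_ :-_
    using () renaming (_-ᵥ_ to _:-ᵥ_; _∙_ to _:∙_; det to :det; ‖_‖² to :‖_‖²; _*ᵥ_ to _:*ᵥ_)

  dist²≡0⇒≡ : ∀ p q → dist² p q ≡ 0# → p ≡ q
  dist²≡0⇒≡ (p₁ , p₂) (q₁ , q₂) h = cong₂ _,_
    (x-y≡0⇒x≡y (x*x+y*y≡0⇒x≡0 (p₁ - q₁) (p₂ - q₂) h))
    (x-y≡0⇒x≡y (x*x+y*y≡0⇒x≡0 (p₂ - q₂) (p₁ - q₁) (trans (+-comm _ _) h)))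

  dist²-sym : ∀ p q → dist² p q ≡ dist² q p
  dist²-sym (p₁ , p₂) (q₁ , q₂) = solve 4 (λ p₁ p₂ q₁ q₂ →
    let p = (p₁ , p₂) ; q = (q₁ , q₂) in :‖ p :-ᵥ q ‖² := :‖ q :-ᵥ p ‖²) refl p₁ p₂ q₁ q₂

  dist²-self : ∀ p → dist² p p ≡ 0#
  dist²-self (p₁ , p₂) = combination₂≡0 (p₁ - p₁) (p₂ - p₂) refl (-‿inverseʳ p₁) (-‿inverseʳ p₂)

  dist²-scale : ∀ s p q → dist² (s *ᵥ p) (s *ᵥ q) ≡ (s * s) * dist² p q
  dist²-scale s (p₁ , p₂) (q₁ , q₂) = solve 5 (λ s p₁ p₂ q₁ q₂ →
    let p = (p₁ , p₂) ; q = (q₁ , q₂) in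
    :‖ (s :*ᵥ p) :-ᵥ (s :*ᵥ q) ‖² := (s :* s) :* :‖ p :-ᵥ q ‖²) refl s p₁ p₂ q₁ q₂

  *ᵥ-cancelˡ : ∀ {s p q} → s ≢ 0# → s *ᵥ p ≡ s *ᵥ q → p ≡ q
  *ᵥ-cancelˡ s≢0 sp≡sq =
    cong₂ _,_ (*-cancelˡ-≡ s≢0 (cong proj₁ sp≡sq)) (*-cancelˡ-≡ s≢0 (cong proj₂ sp≡sq))

  radical-axis : ∀ x z a b → dist² x b ≡ dist² x a → dist² b z ≡ dist² a z →
                 (b -ᵥ a) ∙ (z -ᵥ x) ≡ 0#
  radical-axis x@(x₁ , x₂) z@(z₁ , z₂) a@(a₁ , a₂) b@(b₁ , b₂) xb≡xa bz≡az = x+x≡0⇒x≡0 (begin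
    (b -ᵥ a) ∙ (z -ᵥ x) + (b -ᵥ a) ∙ (z -ᵥ x)
      ≡⟨ identity ⟩
    (dist² x b - dist² b z) - (dist² x a - dist² a z)
      ≡⟨ cong₂ (λ s t → (s - t) - (dist² x a - dist² a z)) xb≡xa bz≡az ⟩
    (dist² x a - dist² a z) - (dist² x a - dist² a z)
      ≡⟨ -‿inverseʳ _ ⟩
    0#
      ∎)
    where
    identity : (b -ᵥ a) ∙ (z -ᵥ x) + (b -ᵥ a) ∙ (z -ᵥ x) ≡
               (dist² x b - dist² b z) - (dist² x a - dist² a z)
    identity = solve 8 (λ x₁ x₂ z₁ z₂ a₁ a₂ b₁ b₂ →
      let x = (x₁ , x₂) ; z = (z₁ , z₂) ; a = (a₁ , a₂) ; b = (b₁ , b₂) in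
      (b :-ᵥ a) :∙ (z :-ᵥ x) :+ (b :-ᵥ a) :∙ (z :-ᵥ x) :=
      (:‖ x :-ᵥ b ‖² :- :‖ b :-ᵥ z ‖²) :- (:‖ x :-ᵥ a ‖² :- :‖ a :-ᵥ z ‖²))
      refl x₁ x₂ z₁ z₂ a₁ a₂ b₁ b₂

  orthogonal⇒parallel : ∀ p q d → ‖ d ‖² ≢ 0# → p ∙ d ≡ 0# → q ∙ d ≡ 0# → det p q ≡ 0#
  orthogonal⇒parallel p@(p₁ , p₂) q@(q₁ , q₂) d@(d₁ , d₂) ‖d‖²≢0 p∙d≡0 q∙d≡0 =
    x≢0∧x*y≡0⇒y≡0 ‖d‖²≢0 (combination₂≡0 (det d q) (det p d) identity p∙d≡0 q∙d≡0)
    where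
    identity : ‖ d ‖² * det p q ≡ det d q * (p ∙ d) + det p d * (q ∙ d)
    identity = solve 6 (λ p₁ p₂ q₁ q₂ d₁ d₂ →
      let p = (p₁ , p₂) ; q = (q₁ , q₂) ; d = (d₁ , d₂) in
      :‖ d ‖² :* :det p q := :det d q :* (p :∙ d) :+ :det p d :* (q :∙ d))
      refl p₁ p₂ q₁ q₂ d₁ d₂

  -- With u = a − x, p = b − a, q = c − a the circle equations read 2u·p + |p|² = 0 and
  -- 2u·q + |q|² = 0; together with det p q = 0 they make |p|²(|q|² − p·q) and |q|²(|p|² − p·q)
  -- vanish, hence |p|² = p·q = |q|² and |b − c|² = |p − q|² = 0.
  collinear-on-circle : ∀ x a b c → dist² x b ≡ dist² x a → dist² x c ≡ dist² x a →
                        det (b -ᵥ a) (c -ᵥ a) ≡ 0# → a ≢ b → a ≢ c → b ≡ c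
  collinear-on-circle x@(x₁ , x₂) a@(a₁ , a₂) b@(b₁ , b₂) c@(c₁ , c₂) xb≡xa xc≡xa det≡0 a≢b a≢c =
    dist²≡0⇒≡ b c (begin
      dist² b c            ≡⟨ dist²-bc ⟩
      (α - β) + (γ - β)    ≡⟨ cong₂ _+_ α-β≡0 γ-β≡0 ⟩
      0# + 0#              ≡⟨ +-identityʳ 0# ⟩
      0#                   ∎)
    where
    p q u : Point
    p = b -ᵥ a
    q = c -ᵥ a
    u = a -ᵥ x
    α β γ : Carrier
    α = ‖ p ‖²
    β = p ∙ q
    γ = ‖ q ‖²
    dist²-bc : dist² b c ≡ (α - β) + (γ - β)
    dist²-bc = solve 6 (λ a₁ a₂ b₁ b₂ c₁ c₂ →
      let a = (a₁ , a₂) ; b = (b₁ , b₂) ; c = (c₁ , c₂) ; p = b :-ᵥ a ; q = c :-ᵥ a in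
      :‖ b :-ᵥ c ‖² := (:‖ p ‖² :- p :∙ q) :+ (:‖ q ‖² :- p :∙ q)) refl a₁ a₂ b₁ b₂ c₁ c₂
    α-weighted : α * (γ - β) ≡ α * (dist² x c - dist² x a) + (- β) * (dist² x b - dist² x a)
                               + (- (det p u + det p u)) * det p q
    α-weighted = solve 8 (λ x₁ x₂ a₁ a₂ b₁ b₂ c₁ c₂ →
      let x = (x₁ , x₂) ; a = (a₁ , a₂) ; b = (b₁ , b₂) ; c = (c₁ , c₂)
          p = b :-ᵥ a ; q = c :-ᵥ a ; u = a :-ᵥ x in
      :‖ p ‖² :* (:‖ q ‖² :- p :∙ q) :=
      :‖ p ‖² :* (:‖ x :-ᵥ c ‖² :- :‖ x :-ᵥ a ‖²)
        :+ (:- (p :∙ q)) :* (:‖ x :-ᵥ b ‖² :- :‖ x :-ᵥ a ‖²)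
        :+ (:- (:det p u :+ :det p u)) :* :det p q)
      refl x₁ x₂ a₁ a₂ b₁ b₂ c₁ c₂
    γ-weighted : γ * (α - β) ≡ γ * (dist² x b - dist² x a) + (- β) * (dist² x c - dist² x a)
                               + (det q u + det q u) * det p q
    γ-weighted = solve 8 (λ x₁ x₂ a₁ a₂ b₁ b₂ c₁ c₂ →
      let x = (x₁ , x₂) ; a = (a₁ , a₂) ; b = (b₁ , b₂) ; c = (c₁ , c₂)
          p = b :-ᵥ a ; q = c :-ᵥ a ; u = a :-ᵥ x in
      :‖ q ‖² :* (:‖ p ‖² :- p :∙ q) :=
      :‖ q ‖² :* (:‖ x :-ᵥ b ‖² :- :‖ x :-ᵥ a ‖²)
        :+ (:- (p :∙ q)) :* (:‖ x :-ᵥ c ‖² :- :‖ x :-ᵥ a ‖²)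
        :+ (:det q u :+ :det q u) :* :det p q)
      refl x₁ x₂ a₁ a₂ b₁ b₂ c₁ c₂
    γ-β≡0 : γ - β ≡ 0#
    γ-β≡0 = x≢0∧x*y≡0⇒y≡0 (λ α≡0 → a≢b (sym (dist²≡0⇒≡ b a α≡0)))
      (combination₃≡0 α (- β) _ α-weighted (x≡y⇒x-y≡0 xc≡xa) (x≡y⇒x-y≡0 xb≡xa) det≡0)
    α-β≡0 : α - β ≡ 0#
    α-β≡0 = x≢0∧x*y≡0⇒y≡0 (λ γ≡0 → a≢c (sym (dist²≡0⇒≡ c a γ≡0)))
      (combination₃≡0 γ (- β) _ γ-weighted (x≡y⇒x-y≡0 xb≡xa) (x≡y⇒x-y≡0 xc≡xa) det≡0)

  two-circles : ∀ x z a b c → x ≢ z →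
                dist² x b ≡ dist² x a → dist² x c ≡ dist² x a →
                dist² b z ≡ dist² a z → dist² c z ≡ dist² a z →
                a ≢ b → a ≢ c → b ≡ c
  two-circles x z a b c x≢z xb≡xa xc≡xa bz≡az cz≡az =
    collinear-on-circle x a b c xb≡xa xc≡xa
      (orthogonal⇒parallel (b -ᵥ a) (c -ᵥ a) (z -ᵥ x) (λ h → x≢z (sym (dist²≡0⇒≡ z x h)))
        (radical-axis x z a b xb≡xa bz≡az) (radical-axis x z a c xc≡xa cz≡az))

module UnitDistances (R : RealField) where
  open RealField R
  open RealFieldProperties R
  open PlaneGeometry R
  open Plane R using (PointSet; AtDist; UnitPair; UnitDistBound; dist²)

  AtDist⇒≢ : ∀ {p q δ} → δ ≢ 0# → AtDist p q δ → p ≢ q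
  AtDist⇒≢ {p} δ≢0 pq≡δδ refl = 0<x⇒x≢0 (x≢0⇒0<x*x δ≢0) (trans (sym pq≡δδ) (dist²-self p))

  AtDist-scale : ∀ {p q δ} s → AtDist p q δ → AtDist (s *ᵥ p) (s *ᵥ q) (s * δ)
  AtDist-scale {p} {q} {δ} s pq≡δδ = begin
    dist² (s *ᵥ p) (s *ᵥ q)   ≡⟨ dist²-scale s p q ⟩
    (s * s) * dist² p q       ≡⟨ cong ((s * s) *_) pq≡δδ ⟩
    (s * s) * (δ * δ)         ≡⟨ solve 2 (λ s δ → (s :* s) :* (δ :* δ) := (s :* δ) :* (s :* δ))
                                   refl s δ ⟩
    (s * δ) * (s * δ)         ∎
    where open ≡-Reasoning

  scaled : ∀ {n} s → s ≢ 0# → PointSet n → PointSet n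
  scaled s s≢0 (f , f-injective) = (λ i → s *ᵥ f i) , f-injective ∘ *ᵥ-cancelˡ s≢0

  module _ {n : ℕ} where

    sortPair : Fin n × Fin n → Fin n × Fin n
    sortPair (i , j) with Fin.<-cmp i j
    ... | tri> _ _ _ = j , i
    ... | _ = i , j

    sortPair-∈ : ∀ ij → ij ∈ sortPair ij ∷ swap (sortPair ij) ∷ []
    sortPair-∈ (i , j) with Fin.<-cmp i j
    ... | tri< _ _ _ = here refl
    ... | tri≈ _ _ _ = here refl
    ... | tri> _ _ _ = there (here refl)

    sortPair-unitPair : (P : PointSet n) → ∀ {i j} → AtDist (proj₁ P i) (proj₁ P j) 1# →
                        UnitPair P (sortPair (i , j))
    sortPair-unitPair P@(f , _) {i} {j} ij≡1 with Fin.<-cmp i j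
    ... | tri< i<j _ _ = i<j , ij≡1
    ... | tri≈ _ i≡j _ = ⊥-elim (AtDist⇒≢ (λ 1≡0 → 0≢1 (sym 1≡0)) ij≡1 (cong f i≡j))
    ... | tri> _ _ j<i = j<i , trans (dist²-sym (f j) (f i)) ij≡1

  module _ {n u : ℕ} (unit-bound : UnitDistBound n u) where

    ordered-unit-pairs : (P : PointSet n) →
                         AtMost (2 ℕ.* u) (λ (i , j) → AtDist (proj₁ P i) (proj₁ P j) 1#)
    ordered-unit-pairs P = AtMost-fibres sortPair _≟²_ (sortPair-unitPair P) fibre (unit-bound P)
      where
      _≟²_ : DecidableEquality (Fin n × Fin n)
      _≟²_ = Product.≡-dec Fin._≟_ Fin._≟_
      fibre : ∀ b → AtMost 2 (λ (i , j) → AtDist (proj₁ P i) (proj₁ P j) 1# × sortPair (i , j) ≡ b)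
      fibre b = AtMost-⊆ (λ { {ij} (_ , refl) → sortPair-∈ ij }) (AtMost-∈ _≟²_ (b ∷ swap b ∷ []))

    pairs-at-distance : (P : PointSet n) → ∀ {δ} → δ ≢ 0# →
                        AtMost (2 ℕ.* u) (λ (i , j) → AtDist (proj₁ P i) (proj₁ P j) δ)
    pairs-at-distance P {δ} δ≢0 with inverse δ δ≢0
    ... | s , δs≡1 =
      AtMost-⊆ (λ ij≡δ → subst (AtDist _ _) (trans (*-comm s δ) δs≡1) (AtDist-scale s ij≡δ))
               (ordered-unit-pairs (scaled s s≢0 P))
      where
      s≢0 : s ≢ 0#
      s≢0 refl = 0≢1 (trans (sym (zeroʳ δ)) δs≡1)

module ChainCounting (R : RealField) {n u : ℕ} (unit-bound : Plane.UnitDistBound R n u)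
                     (P : Plane.PointSet R n) where
  open import Data.Nat using (_*_; _^_; z≤n; s≤s)
  open import Data.Nat.Properties using (≤-reflexive)
  open RealField R using (Carrier; 0#)
  open PlaneGeometry R using (two-circles)
  open UnitDistances R using (pairs-at-distance)
  open Plane R using (Point; AtDist; IsChain)

  f : Fin n → Point
  f = proj₁ P

  f-injective : ∀ {i j} → f i ≡ f j → i ≡ j
  f-injective = proj₂ P

  IsChain-tail : ∀ {k δ} (c : Vec (Fin n) (suc (suc k))) →
                 IsChain (suc k) P δ c → IsChain k P (δ ∘ Fin.suc) (tail c)
  IsChain-tail (_ ∷ _) (distinct , edges) = Fin.suc-injective ∘ distinct , edges ∘ Fin.suc

  IsChain-first-edge : ∀ {k δ} (c : Vec (Fin n) (suc (suc k))) →
                       IsChain (suc k) P δ c → AtDist (f (head c)) (f (head (tail c))) (δ Fin.zero)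
  IsChain-first-edge (_ ∷ _ ∷ _) (_ , edges) = edges Fin.zero

  IsChain-first≢third : ∀ {k δ} (c : Vec (Fin n) (suc (suc (suc k)))) →
                        IsChain (suc (suc k)) P δ c → head c ≢ head (tail (tail c))
  IsChain-first≢third (_ ∷ _ ∷ _ ∷ _) (distinct , _) a≡c
    with distinct {Fin.zero} {Fin.suc (Fin.suc Fin.zero)} a≡c
  ... | ()

  common-neighbours : ∀ δ δ′ i k →
                      AtMost 2 (λ j → i ≢ k × AtDist (f i) (f j) δ × AtDist (f j) (f k) δ′)
  common-neighbours δ δ′ i k [] _ _ = z≤n
  common-neighbours δ δ′ i k (_ ∷ []) _ _ = s≤s z≤n
  common-neighbours δ δ′ i k (_ ∷ _ ∷ []) _ _ = s≤s (s≤s z≤n)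
  common-neighbours δ δ′ i k (a ∷ b ∷ c ∷ _) ((a≢b ∷ a≢c ∷ _) ∷ (b≢c ∷ _) ∷ _)
                    ((i≢k , ia , ak) ∷ (_ , ib , bk) ∷ (_ , ic , ck) ∷ _) =
    ⊥-elim (b≢c (f-injective (two-circles (f i) (f k) (f a) (f b) (f c) (i≢k ∘ f-injective)
      (trans ib (sym ia)) (trans ic (sym ia)) (trans bk (sym ak)) (trans ck (sym ak))
      (a≢b ∘ f-injective) (a≢c ∘ f-injective))))

  second-vertex-choices : ∀ {k} (δ : Fin (suc (suc k)) → Carrier) i (t : Vec (Fin n) (suc k)) →
    AtMost 2 (λ c → IsChain (suc (suc k)) P δ c × head c ≡ i × tail (tail c) ≡ t)
  second-vertex-choices δ i t = AtMost-injection (head ∘ tail)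
    (λ { {c@(_ ∷ _ ∷ _)} (chain , refl , refl) →
         IsChain-first≢third c chain , IsChain-first-edge c chain ,
         IsChain-first-edge (tail c) (IsChain-tail c chain) })
    (λ { {_ ∷ _ ∷ _} {_ ∷ _ ∷ _} (_ , refl , refl) (_ , refl , refl) refl → refl })
    (common-neighbours (δ Fin.zero) (δ (Fin.suc Fin.zero)) i (head t))

  mutual
    chains[3m]-from : ∀ m (δ : Fin (m * 3) → Carrier) → (∀ j → δ j ≢ 0#) → ∀ i →
                      AtMost (4 ^ m * u ^ m) (λ c → IsChain (m * 3) P δ c × head c ≡ i)
    chains[3m]-from zero δ _ i =
      AtMost-injection head proj₂ (λ { {_ ∷ []} {_ ∷ []} _ _ refl → refl }) (AtMost-≡ i)
    chains[3m]-from (suc m) δ δ≢0 i = AtMost-≤ (≤-reflexive (arithmetic (4 ^ m) (u ^ m) u))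
      (AtMost-fibres (tail ∘ tail) (Vec.≡-dec Fin._≟_)
        (λ {c} (chain , _) → IsChain-tail (tail c) (IsChain-tail c chain))
        (λ t → AtMost-⊆ (λ ((chain , first) , rest) → chain , first , rest)
                        (second-vertex-choices δ i t))
        (chains[3m+1] m (δ ∘ Fin.suc ∘ Fin.suc) (δ≢0 ∘ Fin.suc ∘ Fin.suc)))
      where
      arithmetic : ∀ a b u → 2 * (a * b * (2 * u)) ≡ 4 * a * (u * b)
      arithmetic = solve-∀

    chains[3m+1] : ∀ m (δ : Fin (suc (m * 3)) → Carrier) → (∀ j → δ j ≢ 0#) →
                   AtMost (4 ^ m * u ^ m * (2 * u)) (IsChain (suc (m * 3)) P δ)
    chains[3m+1] m δ δ≢0 = AtMost-fibres (λ c → head c , head (tail c))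
      (Product.≡-dec Fin._≟_ Fin._≟_)
      (λ {c} → IsChain-first-edge c)
      (λ (i , j) → AtMost-injection tail
        (λ { {c@(_ ∷ _ ∷ _)} (chain , refl) → IsChain-tail c chain , refl })
        (λ { {_ ∷ _} {_ ∷ _} (_ , refl) (_ , e) refl → cong (_∷ _) (sym (cong proj₁ e)) })
        (chains[3m]-from m (δ ∘ Fin.suc) (δ≢0 ∘ Fin.suc) j))
      (pairs-at-distance unit-bound P (δ≢0 Fin.zero))

  chains[3m] : ∀ m (δ : Fin (m * 3) → Carrier) → (∀ j → δ j ≢ 0#) →
               AtMost (4 ^ m * u ^ m * n) (IsChain (m * 3) P δ)
  chains[3m] m δ δ≢0 =
    AtMost-fibres head Fin._≟_ (λ _ → tt) (chains[3m]-from m δ δ≢0) (AtMost-Fin n)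

  chains[3m+2] : ∀ m (δ : Fin (suc (suc (m * 3))) → Carrier) → (∀ j → δ j ≢ 0#) →
                 AtMost (2 * (4 ^ m * u ^ m * n * n)) (IsChain (suc (suc (m * 3))) P δ)
  chains[3m+2] m δ δ≢0 = AtMost-fibres (λ c → head c , tail (tail c))
    (Product.≡-dec Fin._≟_ (Vec.≡-dec Fin._≟_))
    (λ {c} chain → tt , IsChain-tail (tail c) (IsChain-tail c chain))
    (λ (i , t) → AtMost-⊆ (λ (chain , e) → chain , cong proj₁ e , cong proj₂ e)
                          (second-vertex-choices δ i t))
    (AtMost-× Fin._≟_ (AtMost-Fin n)
      (chains[3m] m (δ ∘ Fin.suc ∘ Fin.suc) (δ≢0 ∘ Fin.suc ∘ Fin.suc)))

open import Data.Nat using (_≤_; _*_; _^_; _/_)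
open import Data.Nat.Properties using (≤-reflexive; +-comm)
open import Data.Nat.DivMod using ([m+kn]%n≡m%n; m*n%n≡0; m*n/n≡m)

data Residue : ℕ → Set where
  [3m]   : ∀ m → Residue (m * 3)
  [3m+1] : ∀ m → Residue (suc (m * 3))
  [3m+2] : ∀ m → Residue (suc (suc (m * 3)))

residue : ∀ k → Residue k
residue zero = [3m] 0
residue (suc k) with residue k
... | [3m] m = [3m+1] m
... | [3m+1] m = [3m+2] m
... | [3m+2] m = [3m] (suc m)

chainBound-[3m] : ∀ m n u → chainBound (m * 3) n u ≡ n * u ^ m
chainBound-[3m] m n u rewrite m*n%n≡0 m 3 ⦃ _ ⦄ | m*n/n≡m m 3 ⦃ _ ⦄ = refl

chainBound-[3m+1] : ∀ m n u → chainBound (suc (m * 3)) n u ≡ u ^ suc m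
chainBound-[3m+1] m n u rewrite [m+kn]%n≡m%n 1 m 3 ⦃ _ ⦄ =
  cong (u ^_) (trans (cong (_/ 3) (+-comm (suc (m * 3)) 2)) (m*n/n≡m (suc m) 3))

chainBound-[3m+2] : ∀ m n u → chainBound (suc (suc (m * 3))) n u ≡ n * n * u ^ m
chainBound-[3m+2] m n u rewrite [m+kn]%n≡m%n 2 m 3 ⦃ _ ⦄ | m*n/n≡m m 3 ⦃ _ ⦄ = refl

chainConstant : ∀ {k} → Residue k → ℕ
chainConstant ([3m] m) = 4 ^ m
chainConstant ([3m+1] m) = 2 * 4 ^ m
chainConstant ([3m+2] m) = 2 * 4 ^ m

module _ (R : RealField) {n u : ℕ} (unit-bound : Plane.UnitDistBound R n u)
         (P : Plane.PointSet R n) where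
  open RealField R using (Carrier; 0#)
  open ChainCounting R unit-bound P

  chains-bounded : ∀ {k} (r : Residue k) (δ : Fin k → Carrier) → (∀ j → δ j ≢ 0#) →
                   AtMost (chainConstant r * chainBound k n u) (Plane.IsChain R k P δ)
  chains-bounded ([3m] m) δ δ≢0 rewrite chainBound-[3m] m n u =
    AtMost-≤ (≤-reflexive (arithmetic (4 ^ m) (u ^ m) n)) (chains[3m] m δ δ≢0)
    where
    arithmetic : ∀ a b n → a * b * n ≡ a * (n * b)
    arithmetic = solve-∀
  chains-bounded ([3m+1] m) δ δ≢0 rewrite chainBound-[3m+1] m n u =
    AtMost-≤ (≤-reflexive (arithmetic (4 ^ m) (u ^ m) u)) (chains[3m+1] m δ δ≢0)
    where
    arithmetic : ∀ a b u → a * b * (2 * u) ≡ 2 * a * (u * b)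
    arithmetic = solve-∀
  chains-bounded ([3m+2] m) δ δ≢0 rewrite chainBound-[3m+2] m n u =
    AtMost-≤ (≤-reflexive (arithmetic (4 ^ m) (u ^ m) n)) (chains[3m+2] m δ δ≢0)
    where
    arithmetic : ∀ a b n → 2 * (a * b * n * n) ≡ 2 * a * (n * n * b)
    arithmetic = solve-∀

-- The bound holds for every k and n.
proposition1p3 : (R : RealField) → (k : ℕ) → 3 ≤ k →
    ∃₂ λ (C N : ℕ) → ∀ (n : ℕ) → N ≤ n →
    ∀ (u : ℕ) → Plane.UnitDistBound R n u →
    ∀ (P : Plane.PointSet R n) (δ : Fin k → RealField.Carrier R) →
    (∀ j → RealField._<_ R (RealField.0# R) (δ j)) →
    ∀ (cs : List (Vec (Fin n) (suc k))) → Unique cs →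
    All (Plane.IsChain R k P δ) cs →
    length cs ≤ C * chainBound k n u
proposition1p3 R k _ = chainConstant (residue k) , 0 , λ n _ u unit-bound P δ δ>0 →
  chains-bounded R unit-bound P (residue k) δ (λ j → RealFieldProperties.0<x⇒x≢0 R (δ>0 j))
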